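{- Let $\lambda=(\lambda_1,\ldots,\lambda_t)$ be an unrefinable partition into distinct parts with $\#\mathcal{M}_\lambda=\lfloor\lambda_t/2\rfloor$. Then $\lambda_t/2$ is not a part of $\lambda$.
   Context: A partition into distinct parts is a sequence $\lambda=(\lambda_1,\ldots,\lambda_t)$ of positive integers with $\lambda_1<\cdots<\lambda_t$ and $t\ge 2$. Its set of missing parts is $\mathcal{M}_\lambda=\{1,\ldots,\lambda_t\}\setminus\{\lambda_1,\ldots,\lambda_t\}$. $\lambda$ is refinable if some part equals a sum of at least two pairwise distinct missing parts, and unrefinable otherwise. -}

module Defs where

open import Data.Nat using (ℕ; zero; suc; _+_; _*_; _<_; _≤_; _/_)
open import Data.List using (List; []; _∷_; length; filter; upTo; map)
open import Data.Nat.ListAction using (sum)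
open import Data.List.Membership.Propositional using (_∈_; _∉_)
open import Data.List.Relation.Unary.All using (All)
open import Data.List.Relation.Unary.Linked using (Linked)
open import Data.List.Relation.Unary.Unique.Propositional using (Unique)
open import Data.List.Membership.DecPropositional Data.Nat._≟_ using (_∈?_)
open import Relation.Nullary.Decidable using (¬?)
open import Relation.Binary.PropositionalEquality using (_≡_)
open import Data.Empty using (⊥)
open import Data.Product using (Σ; _×_; ∃)

record DistinctPartition (parts : List ℕ) : Set where
  field
    positive   : All (λ x → 1 ≤ x) parts
    increasing : Linked _<_ parts
    atLeastTwo : 2 ≤ length parts

-- The largest part λ_t of a nonempty list (0 for the empty list, never used).
largest : List ℕ → ℕ
largest []           = 0
largest (x ∷ [])     = x
largest (x ∷ y ∷ xs) = largest (y ∷ xs)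

oneTo : ℕ → List ℕ
oneTo n = map suc (upTo n)

missing : List ℕ → List ℕ
missing parts = filter (λ m → ¬? (m ∈? parts)) (oneTo (largest parts))

IsMissing : List ℕ → ℕ → Set
IsMissing parts m = (1 ≤ m) × (m ≤ largest parts) × (m ∉ parts)

Refinable : List ℕ → Set
Refinable parts =
  Σ ℕ λ p → (p ∈ parts) ×
    Σ (List ℕ) λ S → All (IsMissing parts) S × Unique S × (2 ≤ length S) × (sum S ≡ p)

Unrefinable : List ℕ → Set
Unrefinable parts = Refinable parts → ⊥

-- Pair each i ∈ {1, …, λ_t − 1} with its mirror image λ_t − i.  If λ_t = 2p with p a part,
-- then no pair consists of two missing parts: the fixed point p is a part, and any other
-- pair of missing parts would sum to the part λ_t.  The last position λ_t is a part as
-- well, so 2 · #M_λ ≤ λ_t − 1 < λ_t, contradicting #M_λ = λ_t / 2.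
module Submission where

open import Defs
open import Data.Nat using (ℕ; zero; suc; _+_; _*_; _/_; _≤_; _<_; z≤n; s≤s; _≟_)
open import Data.Nat.Properties
  using (+-suc; +-identityʳ; m≤m+n; m≤n+m; m≤n⇒m≤1+n; ≤-reflexive; ≤-trans; n<1+n; <-irrefl; *-comm; *-cancelˡ-≡; module ≤-Reasoning)
open import Data.Nat.DivMod using (m*n/n≡m)
open import Data.List using (List; []; _∷_; _++_; _∷ʳ_; length; filter; map; upTo; reverse; applyUpTo; applyDownFrom)
open import Data.List.Properties using (length-++; filter-++; filter-reject; length-applyUpTo; map-upTo; applyUpTo-∷ʳ; reverse-applyUpTo)
open import Data.List.Relation.Binary.Permutation.Propositional.Properties using (↭-length; filter-↭; ↭-reverse)
open import Data.List.Relation.Binary.Pointwise using (Pointwise; []; _∷_)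
open import Data.List.Membership.Propositional using (_∈_; _∉_)
open import Data.List.Membership.DecPropositional Data.Nat._≟_ using (_∈?_)
open import Data.List.Relation.Unary.Any using (here; there)
open import Data.List.Relation.Unary.All using ([]; _∷_; lookup)
open import Data.List.Relation.Unary.AllPairs using ([]; _∷_)
open import Data.Empty using (⊥-elim)
open import Data.Product using (Σ; _×_; _,_)
open import Relation.Unary using (Pred; Decidable)
open import Relation.Nullary using (¬_; yes; no)
open import Relation.Nullary.Decidable using (¬?)
open import Relation.Binary.PropositionalEquality using (_≡_; _≢_; refl; sym; trans; cong; subst; module ≡-Reasoning)

largest∈ : ∀ {x : ℕ} {xs} → x ∈ xs → largest xs ∈ xs
largest∈ {xs = _ ∷ []}     _ = here refl
largest∈ {xs = _ ∷ y ∷ ys} _ = there (largest∈ {xs = y ∷ ys} (here refl))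

applyUpTo-applyDownFrom-pointwise : ∀ {a b r} {A : Set a} {B : Set b} {R : A → B → Set r}
  (f : ℕ → A) (g : ℕ → B) n → (∀ i j → suc (i + j) ≡ n → R (f i) (g j)) →
  Pointwise R (applyUpTo f n) (applyDownFrom g n)
applyUpTo-applyDownFrom-pointwise f g zero    _    = []
applyUpTo-applyDownFrom-pointwise f g (suc n) mirror =
  mirror 0 n refl ∷ applyUpTo-applyDownFrom-pointwise (λ i → f (suc i)) g n (λ i j e → mirror (suc i) j (cong suc e))

module _ {a p} {A : Set a} {P : Pred A p} (P? : Decidable P) where

  count : List A → ℕ
  count xs = length (filter P? xs)

  count-∷ʳ-reject : ∀ {x} xs → ¬ P x → count (xs ∷ʳ x) ≡ count xs
  count-∷ʳ-reject {x} xs ¬px = begin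
    length (filter P? (xs ∷ʳ x))                   ≡⟨ cong length (filter-++ P? xs (x ∷ [])) ⟩
    length (filter P? xs ++ filter P? (x ∷ []))    ≡⟨ length-++ (filter P? xs) ⟩
    count xs + length (filter P? (x ∷ []))         ≡⟨ cong (λ ys → count xs + length ys) (filter-reject P? ¬px) ⟩
    count xs + 0                                   ≡⟨ +-identityʳ (count xs) ⟩
    count xs                                       ∎
    where open ≡-Reasoning

  count-reverse : ∀ xs → count (reverse xs) ≡ count xs
  count-reverse xs = ↭-length (filter-↭ P? (↭-reverse xs))

  count+count≤length : ∀ {xs ys} → Pointwise (λ x y → ¬ (P x × P y)) xs ys → count xs + count ys ≤ length xs
  count+count≤length [] = z≤n
  count+count≤length {x ∷ xs} {y ∷ ys} (disjoint ∷ rest) with P? x | P? y | count+count≤length rest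
  ... | yes px | yes py | _  = ⊥-elim (disjoint (px , py))
  ... | yes _  | no _   | ih = s≤s ih
  ... | no _   | yes _  | ih = subst (_≤ suc (length xs)) (sym (+-suc (count xs) (count ys))) (s≤s ih)
  ... | no _   | no _   | ih = m≤n⇒m≤1+n ih

module _ {parts : List ℕ} where

  refinable-from-missing-pair : ∀ {x y} → largest parts ∈ parts → x + y ≡ largest parts →
    1 ≤ x → 1 ≤ y → x ≢ y → x ∉ parts → y ∉ parts → Refinable parts
  refinable-from-missing-pair {x} {y} top∈parts x+y≡top 1≤x 1≤y x≢y x∉parts y∉parts =
    largest parts , top∈parts , x ∷ y ∷ [] ,
    ((1≤x , ≤-trans (m≤m+n x y) x+y≤top , x∉parts) ∷ (1≤y , ≤-trans (m≤n+m y x) x+y≤top , y∉parts) ∷ []) ,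
    ((x≢y ∷ []) ∷ [] ∷ []) ,
    s≤s (s≤s z≤n) ,
    trans (cong (x +_) (+-identityʳ y)) x+y≡top
    where
    x+y≤top = ≤-reflexive x+y≡top

  Missing? : Decidable (_∉ parts)
  Missing? m = ¬? (m ∈? parts)

  length-missing≡count : ∀ n → suc n ≡ largest parts → largest parts ∈ parts →
    length (missing parts) ≡ count Missing? (applyUpTo suc n)
  length-missing≡count n top≡ top∈parts = begin
    length (missing parts)                      ≡⟨ cong (λ N → count Missing? (map suc (upTo N))) (sym top≡) ⟩
    count Missing? (map suc (upTo (suc n)))     ≡⟨ cong (count Missing?) (map-upTo suc (suc n)) ⟩
    count Missing? (applyUpTo suc (suc n))      ≡⟨ cong (count Missing?) (sym (applyUpTo-∷ʳ suc n)) ⟩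
    count Missing? (applyUpTo suc n ∷ʳ suc n)   ≡⟨ count-∷ʳ-reject Missing? (applyUpTo suc n) top∉-missing ⟩
    count Missing? (applyUpTo suc n)            ∎
    where
    open ≡-Reasoning
    top∉-missing : ¬ (suc n ∉ parts)
    top∉-missing suc-n∉parts = suc-n∉parts (subst (_∈ parts) (sym top≡) top∈parts)

  twice-count-missing< : ∀ n → suc n ≡ largest parts → Unrefinable parts → largest parts ∈ parts →
    (∀ x → 2 * x ≡ largest parts → x ∈ parts) → 2 * length (missing parts) < largest parts
  twice-count-missing< n top≡ unrefinable top∈parts halves∈parts = begin-strict
    2 * length (missing parts)                         ≡⟨ cong (2 *_) (length-missing≡count n top≡ top∈parts) ⟩
    count Missing? xs + (count Missing? xs + 0)        ≡⟨ cong (count Missing? xs +_) (+-identityʳ _) ⟩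
    count Missing? xs + count Missing? xs              ≡⟨ cong (count Missing? xs +_) (sym mirrored) ⟩
    count Missing? xs + count Missing? (applyDownFrom suc n) ≤⟨ count+count≤length Missing? pairs ⟩
    length xs                                          ≡⟨ length-applyUpTo suc n ⟩
    n                                                  <⟨ n<1+n n ⟩
    suc n                                              ≡⟨ top≡ ⟩
    largest parts                                      ∎
    where
    open ≤-Reasoning
    xs = applyUpTo suc n

    mirrored : count Missing? (applyDownFrom suc n) ≡ count Missing? xs
    mirrored = trans (cong (count Missing?) (sym (reverse-applyUpTo suc n))) (count-reverse Missing? xs)

    pair-sum : ∀ i j → suc (i + j) ≡ n → suc i + suc j ≡ largest parts
    pair-sum i j i+j+1≡n = trans (cong suc (trans (+-suc i j) i+j+1≡n)) top≡

    no-missing-pair : ∀ i j → suc (i + j) ≡ n → ¬ (suc i ∉ parts × suc j ∉ parts)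
    no-missing-pair i j i+j+1≡n (i∉ , j∉) with suc i ≟ suc j
    ... | yes refl = i∉ (halves∈parts (suc i) (trans (cong (suc i +_) (+-identityʳ (suc i))) (pair-sum i j i+j+1≡n)))
    ... | no i≢j   = unrefinable (refinable-from-missing-pair top∈parts (pair-sum i j i+j+1≡n) (s≤s z≤n) (s≤s z≤n) i≢j i∉ j∉)

    pairs : Pointwise (λ x y → ¬ (x ∉ parts × y ∉ parts)) xs (applyDownFrom suc n)
    pairs = applyUpTo-applyDownFrom-pointwise suc suc n no-missing-pair

mainTheorem8 : (parts : List ℕ) → DistinctPartition parts → Unrefinable parts →
    length (missing parts) ≡ largest parts / 2 →
    ¬ (Σ ℕ λ p → (p ∈ parts) × (2 * p ≡ largest parts))
mainTheorem8 parts dp _ _ (zero , 0∈parts , _) = <-irrefl refl (lookup (DistinctPartition.positive dp) 0∈parts)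
mainTheorem8 parts _ unrefinable |M|≡top/2 (p@(suc _) , p∈parts , 2p≡top) = <-irrefl refl (begin-strict
    2 * p                       ≡⟨ cong (2 *_) p≡|M| ⟩
    2 * length (missing parts)  <⟨ twice-count-missing< _ 2p≡top unrefinable (largest∈ p∈parts) halves∈parts ⟩
    largest parts               ≡⟨ sym 2p≡top ⟩
    2 * p                       ∎)
  where
  open ≤-Reasoning

  p≡|M| : p ≡ length (missing parts)
  p≡|M| = sym (trans |M|≡top/2 (trans (cong (_/ 2) (sym 2p≡top))
                                       (subst (λ m → m / 2 ≡ p) (*-comm p 2) (m*n/n≡m p 2))))

  halves∈parts : ∀ x → 2 * x ≡ largest parts → x ∈ parts
  halves∈parts x 2x≡top = subst (_∈ parts) (*-cancelˡ-≡ p x 2 (trans 2p≡top (sym 2x≡top))) p∈parts
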